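{- Let $G,H$ be finite simple connected graphs, fix a root $(r_G,r_H)\in V(G\,\square\,H)$, let $K\in\{G,H\}$ with $\bar K$ the other graph, and let $(S,T)$ be an ordered pair of disjoint subsets of $V(\bar K)$ such that $i\sim_{\bar K} j$ for all $i\in S$, $j\in T$. Put $M=2\pi(G)\pi(H)$. Then every configuration $c$ on $G\,\square\,H$ from which no sequence of pebbling moves places a pebble on $(r_G,r_H)$ satisfies \[ \sum_{i\in S}pair_{K,i}+1\ \le\ \sum_{j\in T}\bigl(\pi(K)-extra_{K,j}\bigr)+M\Bigl(|S|-\sum_{i\in S}x_{K,i,1}\Bigr)+M\bigl(1-y_{K,\pi(\bar K)-|T|}\bigr). \]
   Context: The Cartesian product $G\,\square\,H$ has vertex set $V(G)\times V(H)$, with $(g,h)\sim(g',h')$ iff ($g=g'$ and $h\sim_H h'$) or ($h=h'$ and $g\sim_G g'$). $|X|$ is the number of vertices of $X$. A configuration is a function $c:V(G\,\square\,H)\to\mathbb{Z}_{\ge0}$. A pebbling move removes two pebbles from a vertex and adds one to an adjacent vertex. $\pi(X)$ (pebbling number) is the least $k$ such that from every configuration of size $k$ on $X$ and every root some sequence of pebbling moves places a pebble on the root. For $K\in\{G,H\}$, $\bar K$ is the other graph; for $j\in V(\bar K)$ the $K$-slice $K_j$ is $\{(i,j):i\in V(G)\}$ if $K=G$ and $\{(j,h):h\in V(H)\}$ if $K=H$. For a configuration $c$: $\tilde c_{K,j}=\sum_{u\in K_j}c(u)$; $set_{K,j}=\lfloor\tilde c_{K,j}/\pi(K)\rfloor$;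 $extra_{K,j}=\tilde c_{K,j}-\pi(K)\,set_{K,j}$; $pair_{K,j}=\lfloor extra_{K,j}/2\rfloor$; $sat_{K,j}=\lfloor(\tilde c_{K,j}-extra_{K,j})/|K|\rfloor$; $x_{K,j,t}=1$ if $sat_{K,j}\ge t$ and $0$ otherwise; $y_{K,s}=1$ if $\sum_{j\in V(\bar K)}set_{K,j}\ge s$ and $0$ otherwise. -}

module Defs where

open import Data.Nat using (ℕ; zero; suc; _+_; _*_; _∸_; _≤_; _<_; _≤ᵇ_)
open import Data.Nat.DivMod using (_/_)
open import Data.Bool using (Bool; true; false; if_then_else_; T)
open import Data.Fin using (Fin) renaming (_≟_ to _≟F_)
open import Data.Fin.Subset using (Subset; _∈_; _∉_; ∣_∣)
open import Data.Vec using (lookup)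
open import Data.Product using (Σ; ∃; _×_; _,_)
open import Data.Product.Properties using (≡-dec)
open import Data.Sum using (_⊎_)
open import Relation.Binary.PropositionalEquality using (_≡_)
open import Relation.Binary.Definitions using (DecidableEquality)
open import Relation.Binary.Construct.Closure.ReflexiveTransitive using (Star)
open import Relation.Nullary using (¬_)
open import Relation.Nullary.Decidable using (⌊_⌋)

∑ : (n : ℕ) → (Fin n → ℕ) → ℕ
∑ zero    f = 0
∑ (suc n) f = f Fin.zero + ∑ n (λ i → f (Fin.suc i))

∑∈ : {n : ℕ} → Subset n → (Fin n → ℕ) → ℕ
∑∈ {n} S f = ∑ n (λ i → if lookup S i then f i else 0)

-- natural division with the convention m / 0 = 0 (only relevant in
-- degenerate vacuous cases with an empty graph)
div : ℕ → ℕ → ℕ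
div m zero    = 0
div m (suc n) = m / suc n

record SimpleGraph : Set where
  field
    n      : ℕ
    adj    : Fin n → Fin n → Bool
    sym    : ∀ u v → adj u v ≡ adj v u
    irrefl : ∀ u → adj u u ≡ false

  Adj : Fin n → Fin n → Set
  Adj u v = T (adj u v)

open SimpleGraph public

Connected : SimpleGraph → Set
Connected G = ∀ u v → Star (Adj G) u v

module Pebbling {V : Set} (_≟_ : DecidableEquality V) (A : V → V → Set) where

  Config : Set
  Config = V → ℕ

  step : Config → V → V → Config
  step c u v w = (if ⌊ w ≟ u ⌋ then c w ∸ 2 else c w) + (if ⌊ w ≟ v ⌋ then 1 else 0)

  Move : Config → Config → Set
  Move c c' = Σ V λ u → Σ V λ v → A u v × 2 ≤ c u × c' ≡ step c u v

  Reach : Config → Config → Set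
  Reach = Star Move

  Solvable : Config → V → Set
  Solvable c r = ∃ λ c' → Reach c c' × 1 ≤ c' r

module PebG (G : SimpleGraph) = Pebbling {Fin (n G)} _≟F_ (Adj G)

size : (G : SimpleGraph) → (Fin (n G) → ℕ) → ℕ
size G c = ∑ (n G) c

PebProp : SimpleGraph → ℕ → Set
PebProp G k = ∀ (c : Fin (n G) → ℕ) → size G c ≡ k → ∀ r → PebG.Solvable G c r

IsPebblingNumber : SimpleGraph → ℕ → Set
IsPebblingNumber G k = PebProp G k × (∀ k' → k' < k → ¬ PebProp G k')

ProdV : SimpleGraph → SimpleGraph → Set
ProdV G H = Fin (n G) × Fin (n H)

ProdAdj : (G H : SimpleGraph) → ProdV G H → ProdV G H → Set
ProdAdj G H (g , h) (g' , h') = (g ≡ g' × Adj H h h') ⊎ (h ≡ h' × Adj G g g')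

module PebProd (G H : SimpleGraph) =
  Pebbling {ProdV G H} (≡-dec _≟F_ _≟F_) (ProdAdj G H)

data Side : Set where
  isG isH : Side

Kof : Side → SimpleGraph → SimpleGraph → SimpleGraph
Kof isG G H = G
Kof isH G H = H

Kbar : Side → SimpleGraph → SimpleGraph → SimpleGraph
Kbar isG G H = H
Kbar isH G H = G

pickK : Side → ℕ → ℕ → ℕ
pickK isG a b = a
pickK isH a b = b

pickKbar : Side → ℕ → ℕ → ℕ
pickKbar isG a b = b
pickKbar isH a b = a

pt : (s : Side) (G H : SimpleGraph) →
     Fin (n (Kof s G H)) → Fin (n (Kbar s G H)) → ProdV G H
pt isG G H i j = (i , j)
pt isH G H i j = (j , i)

module Slice (s : Side) (G H : SimpleGraph) (πG πH : ℕ)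
             (c : ProdV G H → ℕ) where

  πK : ℕ
  πK = pickK s πG πH

  πK̄ : ℕ
  πK̄ = pickKbar s πG πH

  nK : ℕ
  nK = n (Kof s G H)

  nK̄ : ℕ
  nK̄ = n (Kbar s G H)

  c~ : Fin nK̄ → ℕ
  c~ j = ∑ nK (λ i → c (pt s G H i j))

  set : Fin nK̄ → ℕ
  set j = div (c~ j) πK

  extra : Fin nK̄ → ℕ
  extra j = c~ j ∸ πK * set j

  pair : Fin nK̄ → ℕ
  pair j = extra j / 2

  sat : Fin nK̄ → ℕ
  sat j = div (c~ j ∸ extra j) nK

  x : Fin nK̄ → ℕ → ℕ
  x j t = if t ≤ᵇ sat j then 1 else 0

  y : ℕ → ℕ
  y t = if t ≤ᵇ ∑ nK̄ set then 1 else 0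

module Submission where

-- Both M-terms vanish only when every slice of S is saturated and the sets of c together with
-- |T| reach π(K̄); otherwise the right-hand side is at least M, which exceeds the number of pairs
-- because each slice has fewer than π(K) of them and there are |K̄| ≤ π(K̄) slices.  In the
-- remaining case we show that if the pairs of S are at least the deficit Σ_{j∈T} (π(K) − extra_j)
-- of T, the root is reachable, by induction on the pairs.  If T is empty there are π(K̄) sets:
-- pebbling inside each K-slice gathers set_j pebbles on (r_K, j), and pebbling inside the K̄-slice
-- of r_K then reaches the root.  Otherwise take j ∈ T and i ∈ S with a pair; slice i is
-- saturated, so it holds more than |K| pebbles and some (v, i) carries two.  The move
-- (v, i) → (v, j) uses up one pair of S and one unit of deficit of T; when it completes a set in
-- slice j, j leaves T while the number of sets grows by one.

open import Defs hiding (sym)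
open import Function using (_∘_; id; const; case_of_)
open import Data.Bool using (true; false; if_then_else_)
open import Data.Nat
  using (ℕ; zero; suc; _+_; _*_; _∸_; _≤_; _<_; _>_; _≤ᵇ_; z≤n; s≤s; _≤?_; _<?_; >-nonZero; >-nonZero⁻¹)
  renaming (_≟_ to _≟ℕ_)
open import Data.Nat.Properties
open import Algebra.Properties.CommutativeSemigroup +-commutativeSemigroup
  using (interchange; x∙yz≈y∙xz; xy∙z≈xz∙y)
open import Data.Nat.DivMod
  using (_/_; _%_; m%n≡m∸m/n*n; m%n<n; m/n*n≤m; m/n≤m; m*n%n≡0; m*n/n≡m; m<n⇒m%n≡m; m<n⇒m/n≡0
        ; +-distrib-/; m/n≡1+[m∸n]/n; m/n≢0⇒n≤m)
open import Data.Fin using (Fin; toℕ; fromℕ<) renaming (zero to fzero; suc to fsuc; _≟_ to _≟F_)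
open import Data.Fin.Properties using (nonZeroIndex; toℕ-fromℕ<; fromℕ<-toℕ; toℕ<n; any?; all?; ¬∀⟶∃¬)
  renaming (suc-injective to fsuc-injective)
open import Data.Fin.Subset using (Subset; _∈_; _∉_; ∣_∣; ⁅_⁆; ∁; _∩_)
open import Data.Fin.Subset.Properties
  using (_∈?_; x∈⁅x⁆; x≢y⇒x∉⁅y⁆; x∈p∩q⁺; x∈p∩q⁻; x∈∁p⇒x∉p; x∉p⇒x∈∁p)
open import Data.Vec using (_∷_; []; lookup)
open import Data.Vec.Functional using () renaming (_∷_ to _◂_)
open import Data.Vec.Properties using (lookup⇒[]=; []=⇒lookup)
open import Data.Product using (∃-syntax; _×_; _,_; proj₁; proj₂)
open import Data.Product.Properties using (≡-dec)
open import Data.Sum using (_⊎_; inj₁; inj₂)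
open import Relation.Binary.PropositionalEquality
open import Relation.Binary.Definitions using (DecidableEquality)
open import Relation.Binary.Construct.Closure.ReflexiveTransitive using (ε; _◅_; _◅◅_)
open import Relation.Nullary using (¬_; yes; no; contradiction; _→-dec_)
open import Relation.Nullary.Decidable using (⌊_⌋)
open import Relation.Nullary.Reflects using (ofʸ)

∑-cong : ∀ m {f g : Fin m → ℕ} → (∀ k → f k ≡ g k) → ∑ m f ≡ ∑ m g
∑-cong zero    eq = refl
∑-cong (suc m) eq = cong₂ _+_ (eq fzero) (∑-cong m (eq ∘ fsuc))

∑-mono : ∀ m {f g : Fin m → ℕ} → (∀ k → f k ≤ g k) → ∑ m f ≤ ∑ m g
∑-mono zero    le = z≤n
∑-mono (suc m) le = +-mono-≤ (le fzero) (∑-mono m (le ∘ fsuc))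

∑-distrib-+ : ∀ m (f g : Fin m → ℕ) → ∑ m (λ k → f k + g k) ≡ ∑ m f + ∑ m g
∑-distrib-+ zero    f g = refl
∑-distrib-+ (suc m) f g =
  trans (cong (f fzero + g fzero +_) (∑-distrib-+ m (f ∘ fsuc) (g ∘ fsuc)))
        (interchange (f fzero) (g fzero) _ _)

∑-const : ∀ m a → ∑ m (λ _ → a) ≡ m * a
∑-const zero    a = refl
∑-const (suc m) a = cong (a +_) (∑-const m a)

∑-∸ : ∀ m {f g : Fin m → ℕ} → (∀ k → f k ≤ g k) → ∑ m g ≡ ∑ m f + ∑ m (λ k → g k ∸ f k)
∑-∸ m {f} {g} f≤g = trans (∑-cong m (λ k → sym (m+[n∸m]≡n (f≤g k)))) (∑-distrib-+ m f _)

∑-≥-term : ∀ m (f : Fin m → ℕ) k → f k ≤ ∑ m f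
∑-≥-term (suc m) f fzero    = m≤m+n _ _
∑-≥-term (suc m) f (fsuc k) = ≤-trans (∑-≥-term m (f ∘ fsuc) k) (m≤n+m _ _)

∑-update : ∀ m {f g : Fin m → ℕ} j a →
           (∀ k → k ≢ j → f k ≡ g k) → g j ≡ a + f j → ∑ m g ≡ a + ∑ m f
∑-update (suc m) {f} {g} fzero a others at-j = begin
  g fzero + ∑ m (g ∘ fsuc)    ≡⟨ cong₂ _+_ at-j (∑-cong m (λ k → sym (others (fsuc k) λ ()))) ⟩
  a + f fzero + ∑ m (f ∘ fsuc) ≡⟨ +-assoc a _ _ ⟩
  a + ∑ (suc m) f              ∎
  where open ≡-Reasoning
∑-update (suc m) {f} {g} (fsuc j) a others at-j = begin
  g fzero + ∑ m (g ∘ fsuc)       ≡⟨ cong₂ _+_ (sym (others fzero λ ()))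
                                      (∑-update m j a (λ k k≢j → others (fsuc k) (k≢j ∘ fsuc-injective)) at-j) ⟩
  f fzero + (a + ∑ m (f ∘ fsuc)) ≡⟨ x∙yz≈y∙xz (f fzero) a _ ⟩
  a + ∑ (suc m) f                 ∎
  where open ≡-Reasoning

∑-mono-< : ∀ m {f g : Fin m → ℕ} → (∀ k → f k ≤ g k) → ∀ j → f j < g j → ∑ m f < ∑ m g
∑-mono-< (suc m) le fzero    lt = +-mono-<-≤ lt (∑-mono m (le ∘ fsuc))
∑-mono-< (suc m) le (fsuc j) lt = +-mono-≤-< (le fzero) (∑-mono-< m (le ∘ fsuc) j lt)

∑-≤-bound : ∀ m (f : Fin m → ℕ) a → (∀ k → f k ≤ a) → ∑ m f ≤ m * a
∑-≤-bound m f a le = ≤-trans (∑-mono m le) (≤-reflexive (∑-const m a))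

∑-large⇒large-term : ∀ m (f : Fin m → ℕ) a → m * a < ∑ m f → ∃[ k ] a < f k
∑-large⇒large-term m f a lt with any? (λ k → a <? f k)
... | yes found = found
... | no  none  = contradiction (∑-≤-bound m f a (λ k → ≮⇒≥ (λ a<fk → none (k , a<fk)))) (<⇒≱ lt)

pigeonhole : ∀ m (f : Fin m → ℕ) → m < ∑ m f → ∃[ k ] 2 ≤ f k
pigeonhole m f lt = ∑-large⇒large-term m f 1 (subst (_< ∑ m f) (sym (*-identityʳ m)) lt)

∑-split : ∀ m (e : Fin m → ℕ) t → t ≤ ∑ m e → ∃[ e₁ ] (∀ k → e₁ k ≤ e k) × ∑ m e₁ ≡ t
∑-split zero    e .0 z≤n = e , (λ ()) , refl
∑-split (suc m) e t t≤∑ with t ≤? e fzero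
... | yes t≤e₀ = t ◂ (λ _ → 0) , (λ { fzero → t≤e₀ ; (fsuc k) → z≤n })
               , trans (cong (t +_) (trans (∑-const m 0) (*-zeroʳ m))) (+-identityʳ t)
... | no  t≰e₀ with ∑-split m (e ∘ fsuc) (t ∸ e fzero)
                      (subst (t ∸ e fzero ≤_) (m+n∸m≡n (e fzero) _) (∸-monoˡ-≤ (e fzero) t≤∑))
...   | e₁ , e₁≤e , ∑e₁ = e fzero ◂ e₁ , (λ { fzero → ≤-refl ; (fsuc k) → e₁≤e k })
                        , trans (cong (e fzero +_) ∑e₁) (m+[n∸m]≡n (<⇒≤ (≰⇒> t≰e₀)))

module _ {m : ℕ} (S : Subset m) where

  restrict-∈ : ∀ {i} (f : Fin m → ℕ) → i ∈ S → (if lookup S i then f i else 0) ≡ f i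
  restrict-∈ f i∈S rewrite []=⇒lookup i∈S = refl

  restrict-∉ : ∀ {i} (f : Fin m → ℕ) → i ∉ S → (if lookup S i then f i else 0) ≡ 0
  restrict-∉ {i} f i∉S with lookup S i in eq
  ... | true  = contradiction (lookup⇒[]= i S eq) i∉S
  ... | false = refl

  restrict-≤ : ∀ i (f : Fin m → ℕ) → (if lookup S i then f i else 0) ≤ f i
  restrict-≤ i f with lookup S i
  ... | true  = ≤-refl
  ... | false = z≤n

  ∑∈-cong : ∀ {f g : Fin m → ℕ} → (∀ k → k ∈ S → f k ≡ g k) → ∑∈ S f ≡ ∑∈ S g
  ∑∈-cong {f} {g} eq = ∑-cong m λ k → case k ∈? S of λ where
    (yes k∈S) → trans (restrict-∈ f k∈S) (trans (eq k k∈S) (sym (restrict-∈ g k∈S)))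
    (no  k∉S) → trans (restrict-∉ f k∉S) (sym (restrict-∉ g k∉S))

  ∑∈-≥-member : ∀ (f : Fin m → ℕ) {i} → i ∈ S → f i ≤ ∑∈ S f
  ∑∈-≥-member f {i} i∈S = subst (_≤ ∑∈ S f) (restrict-∈ f i∈S) (∑-≥-term m _ i)

  ∑∈-≤-bound : ∀ (f : Fin m → ℕ) a → (∀ k → f k ≤ a) → ∑∈ S f ≤ m * a
  ∑∈-≤-bound f a le = ∑-≤-bound m _ a (λ k → ≤-trans (restrict-≤ k f) (le k))

  ∑∈-positive : ∀ (f : Fin m → ℕ) → 1 ≤ ∑∈ S f → ∃[ i ] i ∈ S × 1 ≤ f i
  ∑∈-positive f pos with ∑-large⇒large-term m _ 0 (subst (_< ∑∈ S f) (sym (*-zeroʳ m)) pos)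
  ... | i , 0<fᵢ with i ∈? S
  ...   | yes i∈S = i , i∈S , subst (0 <_) (restrict-∈ f i∈S) 0<fᵢ
  ...   | no  i∉S = contradiction (subst (0 <_) (restrict-∉ f i∉S) 0<fᵢ) (λ ())

  ∑∈-update : ∀ {f g : Fin m → ℕ} {j} a → j ∈ S →
              (∀ k → k ∈ S → k ≢ j → f k ≡ g k) → g j ≡ a + f j → ∑∈ S g ≡ a + ∑∈ S f
  ∑∈-update {f} {g} {j} a j∈S others at-j = ∑-update m j a off-j
    (trans (restrict-∈ g j∈S) (trans at-j (cong (a +_) (sym (restrict-∈ f j∈S)))))
    where
    off-j : ∀ k → k ≢ j → (if lookup S k then f k else 0) ≡ (if lookup S k then g k else 0)
    off-j k k≢j with k ∈? S
    ... | yes k∈S = trans (restrict-∈ f k∈S) (trans (others k k∈S k≢j) (sym (restrict-∈ g k∈S)))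
    ... | no  k∉S = trans (restrict-∉ f k∉S) (sym (restrict-∉ g k∉S))

  ∑∈-full-or-short : ∀ (f : Fin m → ℕ) → (∀ k → f k ≤ 1) →
                     (∀ i → i ∈ S → 1 ≤ f i) ⊎ ∑∈ S f < ∑∈ S (λ _ → 1)
  ∑∈-full-or-short f f≤1 with all? (λ i → i ∈? S →-dec 1 ≤? f i)
  ... | yes full = inj₁ full
  ... | no  ¬full with ¬∀⟶∃¬ m _ (λ i → i ∈? S →-dec 1 ≤? f i) ¬full
  ...   | i , ¬[i∈S⇒1≤fᵢ] with i ∈? S
  ...     | no  i∉S = contradiction (λ i∈S → contradiction i∈S i∉S) ¬[i∈S⇒1≤fᵢ]
  ...     | yes i∈S = inj₂ (∑-mono-< m restricted-≤ i
                         (subst₂ _<_ (sym (restrict-∈ f i∈S)) (sym (restrict-∈ _ i∈S)) (≰⇒> (¬[i∈S⇒1≤fᵢ] ∘ const))))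
    where
    restricted-≤ : ∀ k → (if lookup S k then f k else 0) ≤ (if lookup S k then 1 else 0)
    restricted-≤ k with lookup S k
    ... | true  = f≤1 k
    ... | false = z≤n

∣∣≡∑∈1 : ∀ {m} (S : Subset m) → ∣ S ∣ ≡ ∑∈ S (λ _ → 1)
∣∣≡∑∈1 []          = refl
∣∣≡∑∈1 (true ∷ S)  = cong suc (∣∣≡∑∈1 S)
∣∣≡∑∈1 (false ∷ S) = ∣∣≡∑∈1 S

module _ {m : ℕ} {S : Subset m} {j : Fin m} where

  ∈-remove⁻ : ∀ {k} → k ∈ S ∩ ∁ ⁅ j ⁆ → k ∈ S × k ≢ j
  ∈-remove⁻ k∈ = let k∈S , k∈∁ = x∈p∩q⁻ S (∁ ⁅ j ⁆) k∈
                 in k∈S , λ { refl → x∈∁p⇒x∉p k∈∁ (x∈⁅x⁆ j) }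

  ∈-remove⁺ : ∀ {k} → k ∈ S → k ≢ j → k ∈ S ∩ ∁ ⁅ j ⁆
  ∈-remove⁺ k∈S k≢j = x∈p∩q⁺ (k∈S , x∉p⇒x∈∁p (x≢y⇒x∉⁅y⁆ k≢j))

  ∑∈-remove : ∀ (f : Fin m → ℕ) → j ∈ S → ∑∈ S f ≡ f j + ∑∈ (S ∩ ∁ ⁅ j ⁆) f
  ∑∈-remove f j∈S = ∑-update m j (f j) off-j
    (trans (restrict-∈ S f j∈S) (sym (trans (cong (f j +_) (restrict-∉ _ f j∉)) (+-identityʳ _))))
    where
    off-j : ∀ k → k ≢ j → (if lookup (S ∩ ∁ ⁅ j ⁆) k then f k else 0) ≡ (if lookup S k then f k else 0)
    off-j k k≢j with k ∈? S
    ... | yes k∈S = trans (restrict-∈ _ f (∈-remove⁺ k∈S k≢j)) (sym (restrict-∈ S f k∈S))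
    ... | no  k∉S = trans (restrict-∉ _ f (k∉S ∘ proj₁ ∘ ∈-remove⁻)) (sym (restrict-∉ S f k∉S))
    j∉ : j ∉ S ∩ ∁ ⁅ j ⁆
    j∉ j∈ = proj₂ (∈-remove⁻ j∈) refl

-- A slice with t pebbles has set = div t πK and extra = excess πK t, definitionally.
excess : ℕ → ℕ → ℕ
excess p t = t ∸ p * div t p

p*div≤ : ∀ p t → p * div t p ≤ t
p*div≤ zero    t = z≤n
p*div≤ (suc p) t = subst (_≤ t) (*-comm (t / suc p) (suc p)) (m/n*n≤m t (suc p))

div-excess : ∀ p t → p * div t p + excess p t ≡ t
div-excess p t = m+[n∸m]≡n (p*div≤ p t)

∸-excess : ∀ p t → t ∸ excess p t ≡ p * div t p
∸-excess p t = m∸[m∸n]≡n (p*div≤ p t)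

excess<p : ∀ p t → p > 0 → excess p t < p
excess<p (suc p) t _ =
  subst (_< suc p) (trans (m%n≡m∸m/n*n t (suc p)) (cong (t ∸_) (*-comm (t / suc p) (suc p)))) (m%n<n t (suc p))

div-excess-unique : ∀ p q r {t} → r < p → t ≡ p * q + r → div t p ≡ q × excess p t ≡ r
div-excess-unique (suc p) q r r<p refl =
  div≡q , trans (cong (λ d → suc p * q + r ∸ suc p * d) div≡q) (m+n∸m≡n (suc p * q) r)
  where
  open ≡-Reasoning
  remainders<p : (suc p * q) % suc p + r % suc p < suc p
  remainders<p = subst (_< suc p) (sym (cong₂ _+_ pq%p≡0 (m<n⇒m%n≡m r<p))) r<p
    where
    pq%p≡0 : (suc p * q) % suc p ≡ 0
    pq%p≡0 = trans (cong (_% suc p) (*-comm (suc p) q)) (m*n%n≡0 q (suc p))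
  pq/p≡q : suc p * q / suc p ≡ q
  pq/p≡q = trans (cong (_/ suc p) (*-comm (suc p) q)) (m*n/n≡m q (suc p))
  div≡q : (suc p * q + r) / suc p ≡ q
  div≡q = begin
    (suc p * q + r) / suc p           ≡⟨ +-distrib-/ (suc p * q) r remainders<p ⟩
    suc p * q / suc p + r / suc p     ≡⟨ cong₂ _+_ pq/p≡q (m<n⇒m/n≡0 r<p) ⟩
    q + 0                             ≡⟨ +-identityʳ q ⟩
    q                                 ∎

excess-source : ∀ p t t' → p > 0 → 2 ≤ excess p t → t ≡ 2 + t' →
                div t' p ≡ div t p × excess p t ≡ 2 + excess p t'
excess-source p t t' p>0 2≤e t≡2+t'
  with div-excess-unique p (div t p) (excess p t ∸ 2) (≤-<-trans (m∸n≤m _ 2) (excess<p p t p>0)) t'≡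
  where
  open ≡-Reasoning
  t'≡ : t' ≡ p * div t p + (excess p t ∸ 2)
  t'≡ = begin
    t'                                ≡⟨ cong (_∸ 2) t≡2+t' ⟨
    t ∸ 2                             ≡⟨ cong (_∸ 2) (div-excess p t) ⟨
    p * div t p + excess p t ∸ 2      ≡⟨ +-∸-assoc (p * div t p) 2≤e ⟩
    p * div t p + (excess p t ∸ 2)    ∎
... | div≡ , excess≡ = div≡ , trans (sym (m+[n∸m]≡n 2≤e)) (cong (2 +_) (sym excess≡))

excess-target-below : ∀ p t t' → suc (excess p t) < p → t' ≡ suc t →
                      div t' p ≡ div t p × excess p t' ≡ suc (excess p t)
excess-target-below p t t' 1+e<p t'≡1+t =
  div-excess-unique p (div t p) (suc (excess p t)) 1+e<p
    (trans t'≡1+t (trans (cong suc (sym (div-excess p t))) (sym (+-suc _ _))))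

excess-target-full : ∀ p t t' → suc (excess p t) ≡ p → t' ≡ suc t →
                     div t' p ≡ suc (div t p) × excess p t' ≡ 0
excess-target-full p t t' 1+e≡p t'≡1+t = div-excess-unique p (suc (div t p)) 0 p>0 t'≡
  where
  open ≡-Reasoning
  p>0 : p > 0
  p>0 = subst (_> 0) 1+e≡p (s≤s z≤n)
  t'≡ : t' ≡ p * suc (div t p) + 0
  t'≡ = begin
    t'                               ≡⟨ t'≡1+t ⟩
    suc t                            ≡⟨ cong suc (div-excess p t) ⟨
    suc (p * div t p + excess p t)   ≡⟨ +-suc _ _ ⟨
    p * div t p + suc (excess p t)   ≡⟨ cong (p * div t p +_) 1+e≡p ⟩
    p * div t p + p                  ≡⟨ +-comm _ p ⟩
    p + p * div t p                  ≡⟨ *-suc p _ ⟨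
    p * suc (div t p)                ≡⟨ +-identityʳ _ ⟨
    p * suc (div t p) + 0            ∎

[2+e]/2≡1+e/2 : ∀ e → (2 + e) / 2 ≡ suc (e / 2)
[2+e]/2≡1+e/2 e = m/n≡1+[m∸n]/n {2 + e} {2} (s≤s (s≤s z≤n))

1≤div⇒≤ : ∀ t q → q > 0 → 1 ≤ div t q → q ≤ t
1≤div⇒≤ t (suc q) _ 1≤t/q = m/n≢0⇒n≤m (λ t/q≡0 → <⇒≢ 1≤t/q (sym t/q≡0))

∸≡suc∸suc : ∀ {e p} → e < p → p ∸ e ≡ suc (p ∸ suc e)
∸≡suc∸suc {zero}  {suc p} _         = refl
∸≡suc∸suc {suc e} {suc p} (s≤s e<p) = ∸≡suc∸suc e<p

1≤/2⇒2≤ : ∀ e → 1 ≤ e / 2 → 2 ≤ e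
1≤/2⇒2≤ e 1≤e/2 = m/n≢0⇒n≤m (λ e/2≡0 → <⇒≢ 1≤e/2 (sym e/2≡0))

indicator≤1 : ∀ t u → (if t ≤ᵇ u then 1 else 0) ≤ 1
indicator≤1 t u with t ≤ᵇ u
... | true  = ≤-refl
... | false = z≤n

indicator≡0⊎≤ : ∀ t u → (if t ≤ᵇ u then 1 else 0) ≡ 0 ⊎ t ≤ u
indicator≡0⊎≤ t u with t ≤ᵇ u | ≤ᵇ-reflects-≤ t u
... | true  | ofʸ t≤u = inj₂ t≤u
... | false | _       = inj₁ refl

m≤n+m*a+m*b : ∀ m n a b → 1 ≤ a ⊎ 1 ≤ b → m ≤ n + m * a + m * b
m≤n+m*a+m*b m n a b (inj₁ 1≤a) = ≤-trans (m≤m*n m a {{>-nonZero 1≤a}}) (≤-trans (m≤n+m _ n) (m≤m+n _ _))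
m≤n+m*a+m*b m n a b (inj₂ 1≤b) = ≤-trans (m≤m*n m b {{>-nonZero 1≤b}}) (m≤n+m _ _)

suc≤ : ∀ {m n} → m < n → m + 1 ≤ n
suc≤ {m} {n} = subst (_≤ n) (+-comm 1 m)

module PebblingFacts {V : Set} (_≟_ : DecidableEquality V) (A : V → V → Set) where
  open Pebbling _≟_ A

  step-other : ∀ c {u v w} → w ≢ u → w ≢ v → step c u v w ≡ c w
  step-other c {u} {v} {w} w≢u w≢v with w ≟ u | w ≟ v
  ... | yes w≡u | _       = contradiction w≡u w≢u
  ... | no  _   | yes w≡v = contradiction w≡v w≢v
  ... | no  _   | no  _   = +-identityʳ (c w)

  step-source : ∀ c {u v} → u ≢ v → 2 ≤ c u → c u ≡ 2 + step c u v u
  step-source c {u} {v} u≢v 2≤cu with u ≟ u | u ≟ v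
  ... | no  u≢u | _       = contradiction refl u≢u
  ... | yes _   | yes u≡v = contradiction u≡v u≢v
  ... | yes _   | no  _   = sym (trans (cong (2 +_) (+-identityʳ _)) (m+[n∸m]≡n 2≤cu))

  step-target : ∀ c {u v} → u ≢ v → step c u v v ≡ 1 + c v
  step-target c {u} {v} u≢v with v ≟ u | v ≟ v
  ... | yes v≡u | _       = contradiction (sym v≡u) u≢v
  ... | no  _   | no  v≢v = contradiction refl v≢v
  ... | no  _   | yes _   = +-comm (c v) 1

  solvable-◅ : ∀ {c c' r} → Move c c' → Solvable c' r → Solvable c r
  solvable-◅ move (c'' , moves , pebbled) = c'' , move ◅ moves , pebbled

  reach-≤1 : ∀ {c c'} → (∀ w → c w ≤ 1) → Reach c c' → c' ≡ c
  reach-≤1 ≤1 ε                            = refl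
  reach-≤1 ≤1 ((u , _ , _ , 2≤cu , _) ◅ _) = contradiction (≤-trans 2≤cu (≤1 u)) (λ { (s≤s ()) })

module Lift {V₁ V₂ : Set} (_≟₁_ : DecidableEquality V₁) (_≟₂_ : DecidableEquality V₂)
            (A₁ : V₁ → V₁ → Set) (A₂ : V₂ → V₂ → Set)
            (φ : V₁ → V₂) (φ-injective : ∀ {a b} → φ a ≡ φ b → a ≡ b)
            (φ-adj : ∀ {a b} → A₁ a b → A₂ (φ a) (φ b)) (d : V₂ → ℕ) where
  private
    module P₁ = Pebbling _≟₁_ A₁
    module P₂ = Pebbling _≟₂_ A₂

    +-≤-swap : ∀ {a b c} x → a + b ≤ c → a + x + b ≤ c + x
    +-≤-swap {a} {b} {c} x a+b≤c = subst (_≤ c + x) (xy∙z≈xz∙y a b x) (+-monoˡ-≤ x a+b≤c)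

    ∸2-mono : ∀ {a b c} → 2 ≤ a → a + b ≤ c → a ∸ 2 + b ≤ c ∸ 2
    ∸2-mono {a} {b} {c} 2≤a a+b≤c = subst (_≤ c ∸ 2) (+-∸-comm b 2≤a) (∸-monoˡ-≤ 2 a+b≤c)

  -- c covers e placed along φ on top of a reserve d, which the replayed moves never touch.
  infix 4 _≼_
  _≼_ : (V₁ → ℕ) → (V₂ → ℕ) → Set
  e ≼ c = (∀ w → e w + d (φ w) ≤ c (φ w)) × (∀ z → d z ≤ c z)

  ⌊φ≟φ⌋ : ∀ w u → ⌊ φ w ≟₂ φ u ⌋ ≡ ⌊ w ≟₁ u ⌋
  ⌊φ≟φ⌋ w u with w ≟₁ u | φ w ≟₂ φ u
  ... | yes refl | no  φw≢φw = contradiction refl φw≢φw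
  ... | no  w≢u  | yes φw≡φu = contradiction (φ-injective φw≡φu) w≢u
  ... | yes _    | yes _     = refl
  ... | no  _    | no  _     = refl

  ≼-step : ∀ {e c u v} → 2 ≤ e u → e ≼ c → P₁.step e u v ≼ P₂.step c (φ u) (φ v)
  ≼-step {e} {c} {u} {v} 2≤eu (on-φ , under) = on-φ' , under'
    where
    on-φ' : ∀ w → P₁.step e u v w + d (φ w) ≤ P₂.step c (φ u) (φ v) (φ w)
    on-φ' w rewrite ⌊φ≟φ⌋ w u | ⌊φ≟φ⌋ w v with w ≟₁ u
    ... | yes refl = +-≤-swap {e u ∸ 2} _ (∸2-mono 2≤eu (on-φ u))
    ... | no  _    = +-≤-swap {e w} _ (on-φ w)
    under' : ∀ z → d z ≤ P₂.step c (φ u) (φ v) z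
    under' z with z ≟₂ φ u
    ... | yes refl = ≤-trans (m≤n+m _ _) (≤-trans (∸2-mono 2≤eu (on-φ u)) (m≤m+n _ _))
    ... | no  _    = ≤-trans (under z) (m≤m+n _ _)

  lift : ∀ {e e' c} → P₁.Reach e e' → e ≼ c → ∃[ c' ] P₂.Reach c c' × e' ≼ c'
  lift ε e≼c = _ , ε , e≼c
  lift ((u , v , adj , 2≤eu , refl) ◅ moves) e≼c with lift moves (≼-step 2≤eu e≼c)
  ... | c' , moves' , e'≼c' =
    c' , (φ u , φ v , φ-adj adj , ≤-trans 2≤eu (≤-trans (m≤m+n _ _) (proj₁ e≼c u)) , refl) ◅ moves'
       , e'≼c'

module GraphPebbling (X : SimpleGraph) where
  open PebG X
  open PebblingFacts _≟F_ (Adj X) using (reach-≤1)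
  module LiftX = Lift _≟F_ _≟F_ (Adj X) (Adj X) id id id

  reach-merge : ∀ {e₁ e₁' e₂ e₂' c} → Reach e₁ e₁' → Reach e₂ e₂' → (∀ w → e₁ w + e₂ w ≤ c w) →
                ∃[ c' ] Reach c c' × (∀ w → e₁' w + e₂' w ≤ c' w)
  reach-merge {e₁' = e₁'} {e₂ = e₂} {e₂' = e₂'} {c = c} moves₁ moves₂ e₁+e₂≤c
    with LiftX.lift e₂ moves₁ (e₁+e₂≤c , λ w → ≤-trans (m≤n+m _ _) (e₁+e₂≤c w))
  ... | c₁ , moves₁' , (e₁'+e₂≤c₁ , _)
    with LiftX.lift e₁' moves₂ ( (λ w → subst (_≤ c₁ w) (+-comm (e₁' w) (e₂ w)) (e₁'+e₂≤c₁ w))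
                               , (λ w → ≤-trans (m≤m+n _ _) (e₁'+e₂≤c₁ w)))
  ... | c₂ , moves₂' , (e₂'+e₁'≤c₂ , _) =
    c₂ , moves₁' ◅◅ moves₂' , λ w → subst (_≤ c₂ w) (+-comm (e₂' w) (e₁' w)) (e₂'+e₁'≤c₂ w)

  PebProp⇒solvable : ∀ {k} → PebProp X k → ∀ e → k ≤ size X e → ∀ r → Solvable e r
  PebProp⇒solvable {k} pebbles e k≤∣e∣ r
    with ∑-split (n X) e k k≤∣e∣
  ... | e₁ , e₁≤e , ∣e₁∣≡k
    with pebbles e₁ ∣e₁∣≡k r
  ... | e₁' , moves , pebbled
    with LiftX.lift (λ _ → 0) moves ((λ w → subst (_≤ e w) (sym (+-identityʳ _)) (e₁≤e w)) , λ _ → z≤n)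
  ... | e' , moves' , (e₁'≤e' , _) = e' , moves' , ≤-trans pebbled (subst (_≤ e' r) (+-identityʳ _) (e₁'≤e' r))

  PebProp⇒n≤ : ∀ {k} → PebProp X k → Fin (n X) → n X ≤ k
  PebProp⇒n≤ {k} pebbles r = ≮⇒≥ k≮n
    where
    -- One pebble on every vertex but r, from which no move is possible.
    e : Config
    e w = if ⌊ w ≟F r ⌋ then 0 else 1

    e≤1 : ∀ w → e w ≤ 1
    e≤1 w with w ≟F r
    ... | yes _ = z≤n
    ... | no  _ = ≤-refl

    e-off-root : ∀ w → w ≢ r → e w ≡ 1
    e-off-root w w≢r with w ≟F r
    ... | yes w≡r = contradiction w≡r w≢r
    ... | no  _   = refl

    e-root : e r ≡ 0
    e-root with r ≟F r
    ... | yes _   = refl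
    ... | no  r≢r = contradiction refl r≢r

    n≡1+∣e∣ : n X ≡ 1 + size X e
    n≡1+∣e∣ = trans (sym (trans (∑-const (n X) 1) (*-identityʳ _)))
                    (∑-update (n X) r 1 e-off-root (cong (1 +_) (sym e-root)))

    k≮n : ¬ k < n X
    k≮n k<n with PebProp⇒solvable pebbles e (≤-pred (subst (k <_) n≡1+∣e∣ k<n)) r
    ... | e' , moves , pebbled rewrite reach-≤1 e≤1 moves | e-root = contradiction pebbled (λ ())

  PebProp⇒gather : ∀ {p} → PebProp X p → ∀ r m e → m * p ≤ size X e → ∃[ e' ] Reach e e' × m ≤ e' r
  PebProp⇒gather pebbles r zero    e _ = e , ε , z≤n
  PebProp⇒gather {p} pebbles r (suc m) e [1+m]p≤∣e∣
    with ∑-split (n X) e p (≤-trans (m≤m+n p _) [1+m]p≤∣e∣)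
  ... | e₁ , e₁≤e , ∣e₁∣≡p
    with pebbles e₁ ∣e₁∣≡p r
       | PebProp⇒gather pebbles r m (λ w → e w ∸ e₁ w)
           (+-cancelˡ-≤ p _ _
             (subst (suc m * p ≤_) (trans (∑-∸ (n X) e₁≤e) (cong (_+ _) ∣e₁∣≡p)) [1+m]p≤∣e∣))
  ... | e₁' , moves₁ , pebbled | e₂' , moves₂ , m≤e₂'r
    with reach-merge moves₁ moves₂ (λ w → ≤-reflexive (m+[n∸m]≡n (e₁≤e w)))
  ... | e' , moves , merged = e' , moves , ≤-trans (+-mono-≤ pebbled m≤e₂'r) (merged r)

slice-of : ∀ s G H → ProdV G H → Fin (n (Kbar s G H))
slice-of isG G H (g , h) = h
slice-of isH G H (g , h) = g

slice-of-pt : ∀ s G H a k → slice-of s G H (pt s G H a k) ≡ k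
slice-of-pt isG G H a k = refl
slice-of-pt isH G H a k = refl

pt-injectiveˡ : ∀ s G H {a b k k'} → pt s G H a k ≡ pt s G H b k' → a ≡ b
pt-injectiveˡ isG G H = cong proj₁
pt-injectiveˡ isH G H = cong proj₂

pt-injectiveʳ : ∀ s G H {a b k k'} → pt s G H a k ≡ pt s G H b k' → k ≡ k'
pt-injectiveʳ isG G H = cong proj₂
pt-injectiveʳ isH G H = cong proj₁

pt-adjˡ : ∀ s G H {a b} k → Adj (Kof s G H) a b → ProdAdj G H (pt s G H a k) (pt s G H b k)
pt-adjˡ isG G H k a~b = inj₂ (refl , a~b)
pt-adjˡ isH G H k a~b = inj₁ (refl , a~b)

pt-adjʳ : ∀ s G H v {i j} → Adj (Kbar s G H) i j → ProdAdj G H (pt s G H v i) (pt s G H v j)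
pt-adjʳ isG G H v i~j = inj₁ (refl , i~j)
pt-adjʳ isH G H v i~j = inj₂ (refl , i~j)

PebProp-K : ∀ s {G H πG πH} → PebProp G πG → PebProp H πH → PebProp (Kof s G H) (pickK s πG πH)
PebProp-K isG pebG pebH = pebG
PebProp-K isH pebG pebH = pebH

PebProp-K̄ : ∀ s {G H πG πH} → PebProp G πG → PebProp H πH → PebProp (Kbar s G H) (pickKbar s πG πH)
PebProp-K̄ isG pebG pebH = pebH
PebProp-K̄ isH pebG pebH = pebG

pt-surjective : ∀ s G H (z : ProdV G H) → ∃[ a ] ∃[ k ] pt s G H a k ≡ z
pt-surjective isG G H (g , h) = g , h , refl
pt-surjective isH G H (g , h) = h , g , refl

module ProductPebbling (G H : SimpleGraph) (πG πH : ℕ) (pebG : PebProp G πG) (pebH : PebProp H πH)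
                       (s : Side) where
  open PebProd G H
  open PebblingFacts (≡-dec _≟F_ _≟F_) (ProdAdj G H)
  module SL = Slice s G H πG πH

  K K̄ : SimpleGraph
  K = Kof s G H
  K̄ = Kbar s G H

  πK πK̄ : ℕ
  πK = pickK s πG πH
  πK̄ = pickKbar s πG πH

  pt′ : Fin (n K) → Fin (n K̄) → ProdV G H
  pt′ = pt s G H

  module _ (c : Config) (k : Fin (n K̄)) where

    -- The reserve kept aside while pebbling inside slice k.
    outside : Config
    outside z = if ⌊ slice-of s G H z ≟F k ⌋ then 0 else c z

    outside-on : ∀ a → outside (pt′ a k) ≡ 0
    outside-on a with slice-of s G H (pt′ a k) ≟F k
    ... | yes _  = refl
    ... | no  ≢k = contradiction (slice-of-pt s G H a k) ≢k

    outside-off : ∀ z → slice-of s G H z ≢ k → outside z ≡ c z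
    outside-off z ≢k with slice-of s G H z ≟F k
    ... | yes ≡k = contradiction ≡k ≢k
    ... | no  _  = refl

    outside-≤ : ∀ z → outside z ≤ c z
    outside-≤ z with slice-of s G H z ≟F k
    ... | yes _ = z≤n
    ... | no  _ = ≤-refl

    gather-slice : ∀ r m → m * πK ≤ SL.c~ c k →
                   ∃[ c' ] Reach c c' × m ≤ c' (pt′ r k) × (∀ z → slice-of s G H z ≢ k → c z ≤ c' z)
    gather-slice r m m*πK≤c~
      with GraphPebbling.PebProp⇒gather K (PebProp-K s pebG pebH) r m (λ a → c (pt′ a k)) m*πK≤c~
    ... | e' , moves , m≤e'r
      with Lift.lift _≟F_ (≡-dec _≟F_ _≟F_) (Adj K) (ProdAdj G H) (λ a → pt′ a k)
                     (pt-injectiveˡ s G H) (pt-adjˡ s G H k) outside moves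
                     ( (λ a → ≤-reflexive (trans (cong (c (pt′ a k) +_) (outside-on a)) (+-identityʳ _)))
                     , outside-≤)
    ... | c' , moves' , (on-slice , off-slice) =
      c' , moves' , ≤-trans m≤e'r (≤-trans (m≤m+n _ _) (on-slice r)) ,
      λ z ≢k → subst (_≤ c' z) (outside-off z ≢k) (off-slice z)

  gather-slice-at : ∀ c c₁ r {m} (m<n : m < n K̄) → (∀ z → m ≤ toℕ (slice-of s G H z) → c z ≤ c₁ z) →
    ∃[ c₂ ] Reach c₁ c₂ × SL.set c (fromℕ< m<n) ≤ c₂ (pt′ r (fromℕ< m<n))
                        × (∀ z → toℕ (slice-of s G H z) ≢ m → c₁ z ≤ c₂ z)
  gather-slice-at c c₁ r {m} m<n untouched
    with gather-slice c₁ (fromℕ< m<n) r (SL.set c (fromℕ< m<n)) set*πK≤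
    where
    set*πK≤ : SL.set c (fromℕ< m<n) * πK ≤ SL.c~ c₁ (fromℕ< m<n)
    set*πK≤ = ≤-trans (≤-trans (≤-reflexive (*-comm _ πK)) (p*div≤ πK (SL.c~ c (fromℕ< m<n))))
                      (∑-mono (n K) λ a → untouched (pt′ a (fromℕ< m<n))
                        (≤-reflexive (sym (trans (cong toℕ (slice-of-pt s G H a _)) (toℕ-fromℕ< m<n)))))
  ... | c₂ , moves , gathered , others =
    c₂ , moves , gathered , λ z ≢m → others z λ eq → ≢m (trans (cong toℕ eq) (toℕ-fromℕ< m<n))

  gather-slices : ∀ c r m → m ≤ n K̄ →
    ∃[ c' ] Reach c c' × (∀ k → toℕ k < m → SL.set c k ≤ c' (pt′ r k))
                       × (∀ z → m ≤ toℕ (slice-of s G H z) → c z ≤ c' z)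
  gather-slices c r zero    _   = c , ε , (λ _ ()) , (λ _ _ → ≤-refl)
  gather-slices c r (suc m) m<n
    with gather-slices c r m (<⇒≤ m<n)
  ... | c₁ , moves₁ , done₁ , untouched₁
    with gather-slice-at c c₁ r m<n untouched₁
  ... | c₂ , moves₂ , gathered , others = c₂ , moves₁ ◅◅ moves₂ , done₂ , untouched₂
    where
    done₂ : ∀ k → toℕ k < suc m → SL.set c k ≤ c₂ (pt′ r k)
    done₂ k k<1+m with toℕ k ≟ℕ m
    ... | yes refl rewrite fromℕ<-toℕ k m<n = gathered
    ... | no  k≢m = ≤-trans (done₁ k (≤∧≢⇒< (≤-pred k<1+m) k≢m))
                            (others (pt′ r k) (k≢m ∘ trans (sym (cong toℕ (slice-of-pt s G H r k)))))
    untouched₂ : ∀ z → suc m ≤ toℕ (slice-of s G H z) → c z ≤ c₂ z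
    untouched₂ z m<kz = ≤-trans (untouched₁ z (<⇒≤ m<kz)) (others z (>⇒≢ m<kz))

  solvable-from-sets : ∀ c rK rK̄ → πK̄ ≤ ∑ (n K̄) (SL.set c) → Solvable c (pt′ rK rK̄)
  solvable-from-sets c rK rK̄ πK̄≤∑set
    with gather-slices c rK (n K̄) ≤-refl
  ... | c₁ , moves₁ , gathered , _
    with GraphPebbling.PebProp⇒solvable K̄ (PebProp-K̄ s pebG pebH) (λ k → c₁ (pt′ rK k))
           (≤-trans πK̄≤∑set (∑-mono (n K̄) λ k → gathered k (toℕ<n k))) rK̄
  ... | e' , moves , pebbled
    with Lift.lift _≟F_ (≡-dec _≟F_ _≟F_) (Adj K̄) (ProdAdj G H) (pt′ rK)
                   (pt-injectiveʳ s G H) (pt-adjʳ s G H rK) (λ _ → 0) moves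
                   ((λ k → ≤-reflexive (+-identityʳ _)) , (λ _ → z≤n))
  ... | c₂ , moves₂ , (on-slice , _) =
    c₂ , moves₁ ◅◅ moves₂ , ≤-trans pebbled (subst (_≤ c₂ (pt′ rK rK̄)) (+-identityʳ _) (on-slice rK̄))

  module Across (c : Config) (v : Fin (n K)) {i j : Fin (n K̄)} (i≢j : i ≢ j) where
    c' : Config
    c' = step c (pt′ v i) (pt′ v j)

    move : 2 ≤ c (pt′ v i) → Adj K̄ i j → Move c c'
    move 2≤cvi i~j = pt′ v i , pt′ v j , pt-adjʳ s G H v i~j , 2≤cvi , refl

    private
      vi≢vj : pt′ v i ≢ pt′ v j
      vi≢vj = i≢j ∘ pt-injectiveʳ s G H

    c~-other : ∀ k → k ≢ i → k ≢ j → SL.c~ c' k ≡ SL.c~ c k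
    c~-other k k≢i k≢j = ∑-cong (n K) λ a →
      step-other c (k≢i ∘ pt-injectiveʳ s G H) (k≢j ∘ pt-injectiveʳ s G H)

    c~-source : 2 ≤ c (pt′ v i) → SL.c~ c i ≡ 2 + SL.c~ c' i
    c~-source 2≤cvi = ∑-update (n K) v 2
      (λ a a≢v → step-other c (a≢v ∘ pt-injectiveˡ s G H) (i≢j ∘ pt-injectiveʳ s G H))
      (step-source c vi≢vj 2≤cvi)

    c~-target : SL.c~ c' j ≡ 1 + SL.c~ c j
    c~-target = ∑-update (n K) v 1
      (λ a a≢v → sym (step-other c (i≢j ∘ sym ∘ pt-injectiveʳ s G H) (a≢v ∘ pt-injectiveˡ s G H)))
      (step-target c vi≢vj)

    set-other : ∀ k → k ≢ i → k ≢ j → SL.set c' k ≡ SL.set c k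
    set-other k k≢i k≢j = cong (λ t → div t πK) (c~-other k k≢i k≢j)

    extra-other : ∀ k → k ≢ i → k ≢ j → SL.extra c' k ≡ SL.extra c k
    extra-other k k≢i k≢j = cong (excess πK) (c~-other k k≢i k≢j)

    source : πK > 0 → 2 ≤ c (pt′ v i) → 2 ≤ SL.extra c i →
             SL.set c' i ≡ SL.set c i × SL.pair c i ≡ suc (SL.pair c' i)
    source πK>0 2≤cvi 2≤extra with excess-source πK _ _ πK>0 2≤extra (c~-source 2≤cvi)
    ... | set≡ , extra≡ = set≡ , trans (cong (_/ 2) extra≡) ([2+e]/2≡1+e/2 (SL.extra c' i))

  module Transfer (S : Subset (n K̄)) (rK : Fin (n K)) (rK̄ : Fin (n K̄)) where

    nK>0 : n K > 0
    nK>0 = >-nonZero⁻¹ (n K) {{nonZeroIndex rK}}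

    πK>0 : πK > 0
    πK>0 = ≤-trans nK>0 (GraphPebbling.PebProp⇒n≤ K (PebProp-K s pebG pebH) rK)

    pairs : Config → ℕ
    pairs c = ∑∈ S (SL.pair c)

    deficit : Config → Subset (n K̄) → ℕ
    deficit c T = ∑∈ T (λ j → πK ∸ SL.extra c j)

    record Invariant (c : Config) (T : Subset (n K̄)) : Set where
      field
        disjoint      : ∀ j → j ∈ S → j ∉ T
        complete      : ∀ i j → i ∈ S → j ∈ T → Adj K̄ i j
        saturated     : ∀ i → i ∈ S → 1 ≤ SL.sat c i
        enough-sets   : πK̄ ≤ ∑ (n K̄) (SL.set c) + ∣ T ∣
        deficit≤pairs : deficit c T ≤ pairs c

    module Step {c T i j} (v : Fin (n K)) (inv : Invariant c T) (i∈S : i ∈ S) (j∈T : j ∈ T)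
                (2≤extra : 2 ≤ SL.extra c i) (2≤cvi : 2 ≤ c (pt′ v i)) where
      open Invariant inv

      j∉S : j ∉ S
      j∉S j∈S = disjoint j j∈S j∈T

      i≢j : i ≢ j
      i≢j refl = j∉S i∈S

      open Across c v i≢j public

      set-source : SL.set c' i ≡ SL.set c i
      set-source = proj₁ (source πK>0 2≤cvi 2≤extra)

      set-off-target : ∀ k → k ≢ j → SL.set c' k ≡ SL.set c k
      set-off-target k k≢j with k ≟F i
      ... | yes refl = set-source
      ... | no  k≢i  = set-other k k≢i k≢j

      pairs-drop : pairs c ≡ suc (pairs c')
      pairs-drop = ∑∈-update S 1 i∈S
        (λ k k∈S k≢i → cong (_/ 2) (extra-other k k≢i λ { refl → j∉S k∈S }))
        (proj₂ (source πK>0 2≤cvi 2≤extra))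

      saturated' : ∀ k → k ∈ S → 1 ≤ SL.sat c' k
      saturated' k k∈S = subst (1 ≤_) (sym sat≡) (saturated k k∈S)
        where
        sat≡ : SL.sat c' k ≡ SL.sat c k
        sat≡ = trans (cong (λ t → div t (n K)) (∸-excess πK (SL.c~ c' k)))
               (trans (cong (λ q → div (πK * q) (n K)) (set-off-target k λ { refl → j∉S k∈S }))
                      (sym (cong (λ t → div t (n K)) (∸-excess πK (SL.c~ c k)))))

      assemble : ∀ T' → (∀ k → k ∈ T' → k ∈ T) → deficit c T ≡ suc (deficit c' T') →
                 ∑ (n K̄) (SL.set c') + ∣ T' ∣ ≡ ∑ (n K̄) (SL.set c) + ∣ T ∣ → Invariant c' T'
      assemble T' T'⊆T deficit-drop sets≡ = record
        { disjoint      = λ k k∈S k∈T' → disjoint k k∈S (T'⊆T k k∈T')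
        ; complete      = λ i' j' i'∈S j'∈T' → complete i' j' i'∈S (T'⊆T j' j'∈T')
        ; saturated     = saturated'
        ; enough-sets   = subst (πK̄ ≤_) (sym sets≡) enough-sets
        ; deficit≤pairs = ≤-pred (subst₂ _≤_ deficit-drop pairs-drop deficit≤pairs)
        }

      i∉T : ∀ {k} → k ∈ T → k ≢ i
      i∉T k∈T refl = disjoint i i∈S k∈T

      target-below : suc (SL.extra c j) < πK → Invariant c' T
      target-below 1+e<πK = assemble T (λ _ → id) deficit-drop (cong (_+ ∣ T ∣) (∑-cong (n K̄) set≡))
        where
        target = excess-target-below πK (SL.c~ c j) (SL.c~ c' j) 1+e<πK c~-target
        set≡ : ∀ k → SL.set c' k ≡ SL.set c k
        set≡ k with k ≟F j
        ... | yes refl = proj₁ target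
        ... | no  k≢j  = set-off-target k k≢j
        deficit-drop : deficit c T ≡ suc (deficit c' T)
        deficit-drop = ∑∈-update T 1 j∈T
          (λ k k∈T k≢j → cong (πK ∸_) (extra-other k (i∉T k∈T) k≢j))
          (trans (∸≡suc∸suc (<-trans (n<1+n _) 1+e<πK)) (cong (λ e → suc (πK ∸ e)) (sym (proj₂ target))))

      target-full : suc (SL.extra c j) ≡ πK → Invariant c' (T ∩ ∁ ⁅ j ⁆)
      target-full 1+e≡πK = assemble (T ∩ ∁ ⁅ j ⁆) (λ _ → proj₁ ∘ ∈-remove⁻) deficit-drop sets≡
        where
        target = excess-target-full πK (SL.c~ c j) (SL.c~ c' j) 1+e≡πK c~-target
        ∑set-grows : ∑ (n K̄) (SL.set c') ≡ suc (∑ (n K̄) (SL.set c))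
        ∑set-grows = ∑-update (n K̄) j 1 (λ k k≢j → sym (set-off-target k k≢j)) (proj₁ target)
        ∣T∣-drops : ∣ T ∣ ≡ suc ∣ T ∩ ∁ ⁅ j ⁆ ∣
        ∣T∣-drops = trans (∣∣≡∑∈1 T)
                    (trans (∑∈-remove (λ _ → 1) j∈T) (cong suc (sym (∣∣≡∑∈1 (T ∩ ∁ ⁅ j ⁆)))))
        sets≡ : ∑ (n K̄) (SL.set c') + ∣ T ∩ ∁ ⁅ j ⁆ ∣ ≡ ∑ (n K̄) (SL.set c) + ∣ T ∣
        sets≡ = trans (cong (_+ _) ∑set-grows) (trans (sym (+-suc _ _)) (cong (_ +_) (sym ∣T∣-drops)))
        deficit-j : πK ∸ SL.extra c j ≡ 1
        deficit-j = trans (cong (_∸ SL.extra c j) (sym 1+e≡πK)) (m+n∸n≡m 1 (SL.extra c j))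
        deficit-drop : deficit c T ≡ suc (deficit c' (T ∩ ∁ ⁅ j ⁆))
        deficit-drop = trans (∑∈-remove _ j∈T) (cong₂ _+_ deficit-j (∑∈-cong (T ∩ ∁ ⁅ j ⁆) λ k k∈ →
          let k∈T , k≢j = ∈-remove⁻ k∈ in cong (πK ∸_) (sym (extra-other k (i∉T k∈T) k≢j))))

      invariant-after : ∃[ T' ] Invariant c' T'
      invariant-after with m≤n⇒m<n∨m≡n (excess<p πK (SL.c~ c j) πK>0)
      ... | inj₁ 1+e<πK = T , target-below 1+e<πK
      ... | inj₂ 1+e≡πK = T ∩ ∁ ⁅ j ⁆ , target-full 1+e≡πK

    overfull : ∀ {c i} → 1 ≤ SL.sat c i → 2 ≤ SL.extra c i → n K < SL.c~ c i
    overfull {c} {i} 1≤sat 2≤extra = begin-strict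
      n K                             ≤⟨ 1≤div⇒≤ _ (n K) nK>0 1≤sat ⟩
      SL.c~ c i ∸ SL.extra c i        ≡⟨ ∸-excess πK (SL.c~ c i) ⟩
      πK * SL.set c i                 <⟨ m<m+n _ (≤-trans (s≤s z≤n) 2≤extra) ⟩
      πK * SL.set c i + SL.extra c i  ≡⟨ div-excess πK (SL.c~ c i) ⟩
      SL.c~ c i                       ∎
      where open ≤-Reasoning

    transfer : ∀ {c T j} → Invariant c T → j ∈ T →
               ∃[ c' ] ∃[ T' ] Move c c' × Invariant c' T' × pairs c ≡ suc (pairs c')
    transfer {c} {T} {j} inv j∈T
      with ∑∈-positive S (SL.pair c) (≤-trans 1≤deficit deficit≤pairs)
      where
      open Invariant inv
      1≤deficit : 1 ≤ deficit c T
      1≤deficit = ≤-trans (m<n⇒0<n∸m (excess<p πK (SL.c~ c j) πK>0)) (∑∈-≥-member T _ j∈T)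
    ... | i , i∈S , 1≤pair
      with pigeonhole (n K) (λ a → c (pt′ a i)) (overfull {c} {i} (saturated i i∈S) (1≤/2⇒2≤ _ 1≤pair))
      where open Invariant inv
    ... | v , 2≤cvi = c' , T' , move 2≤cvi (complete i j i∈S j∈T) , inv' , pairs-drop
      where
      open Invariant inv
      open Step v inv i∈S j∈T (1≤/2⇒2≤ _ 1≤pair) 2≤cvi
      T' = proj₁ invariant-after
      inv' = proj₂ invariant-after

    solvable : ∀ m {c T} → pairs c ≡ m → Invariant c T → Solvable c (pt′ rK rK̄)
    after-transfer : ∀ m {c} → pairs c ≡ m →
                     (∃[ c' ] ∃[ T' ] Move c c' × Invariant c' T' × pairs c ≡ suc (pairs c')) →
                     Solvable c (pt′ rK rK̄)

    solvable m {c} {T} pairs≡m inv with ∣ T ∣ ≟ℕ 0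
    ... | yes ∣T∣≡0 = solvable-from-sets c rK rK̄
                        (subst (πK̄ ≤_) (trans (cong (_ +_) ∣T∣≡0) (+-identityʳ _)) (Invariant.enough-sets inv))
    ... | no  ∣T∣≢0 with ∑∈-positive T (λ _ → 1) (subst (1 ≤_) (∣∣≡∑∈1 T) (n≢0⇒n>0 ∣T∣≢0))
    ...   | j , j∈T , _ = after-transfer m pairs≡m (transfer inv j∈T)

    after-transfer zero    pairs≡0 (_ , _ , _ , _ , drop) = contradiction (trans (sym drop) pairs≡0) λ ()
    after-transfer (suc m) pairs≡m (_ , _ , move , inv' , drop) =
      solvable-◅ move (solvable m (suc-injective (trans (sym drop) pairs≡m)) inv')

    pairs<deficit : ∀ {c T} → (∀ j → j ∈ S → j ∉ T) → (∀ i j → i ∈ S → j ∈ T → Adj K̄ i j) →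
                    (∀ i → i ∈ S → 1 ≤ SL.sat c i) → πK̄ ≤ ∑ (n K̄) (SL.set c) + ∣ T ∣ →
                    ¬ Solvable c (pt′ rK rK̄) → pairs c < deficit c T
    pairs<deficit {c} {T} disjoint complete saturated enough-sets unsolvable with pairs c <? deficit c T
    ... | yes pairs<deficit = pairs<deficit
    ... | no  pairs≮deficit = contradiction (solvable _ refl inv) unsolvable
      where
      inv : Invariant c T
      inv = record { disjoint = disjoint ; complete = complete ; saturated = saturated
                   ; enough-sets = enough-sets ; deficit≤pairs = ≮⇒≥ pairs≮deficit }

    pairs<2πK̄πK : ∀ c → pairs c < 2 * (πK̄ * πK)
    pairs<2πK̄πK c = begin-strict
      pairs c                  ≤⟨ ∑∈-≤-bound S (SL.pair c) πK pair≤πK ⟩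
      n K̄ * πK                 ≤⟨ *-monoˡ-≤ πK nK̄≤πK̄ ⟩
      πK̄ * πK                  <⟨ m<m+n (πK̄ * πK) (≤-trans 0<πK̄πK (m≤m+n _ 0)) ⟩
      2 * (πK̄ * πK)            ∎
      where
      open ≤-Reasoning
      nK̄≤πK̄ : n K̄ ≤ πK̄
      nK̄≤πK̄ = GraphPebbling.PebProp⇒n≤ K̄ (PebProp-K̄ s pebG pebH) rK̄
      pair≤πK : ∀ k → SL.pair c k ≤ πK
      pair≤πK k = ≤-trans (m/n≤m (SL.extra c k) 2) (<⇒≤ (excess<p πK (SL.c~ c k) πK>0))
      0<πK̄πK : 0 < πK̄ * πK
      0<πK̄πK = *-mono-≤ (≤-trans (>-nonZero⁻¹ (n K̄) {{nonZeroIndex rK̄}}) nK̄≤πK̄) πK>0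

    pairs-bound : ∀ {c T} → (∀ j → j ∈ S → j ∉ T) → (∀ i j → i ∈ S → j ∈ T → Adj K̄ i j) →
                  ¬ Solvable c (pt′ rK rK̄) →
                  pairs c + 1 ≤ deficit c T + 2 * (πK̄ * πK) * (∣ S ∣ ∸ ∑∈ S (λ i → SL.x c i 1))
                                            + 2 * (πK̄ * πK) * (1 ∸ SL.y c (πK̄ ∸ ∣ T ∣))
    pairs-bound {c} {T} disjoint complete unsolvable
      with ∑∈-full-or-short S (λ i → SL.x c i 1) (λ i → indicator≤1 1 (SL.sat c i))
         | indicator≡0⊎≤ (πK̄ ∸ ∣ T ∣) (∑ (n K̄) (SL.set c))
    ... | inj₂ short | _ = suc≤ (≤-trans (pairs<2πK̄πK c) (m≤n+m*a+m*b _ _ _ _ (inj₁ (m<n⇒0<n∸m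
                             (subst (∑∈ S (λ i → SL.x c i 1) <_) (sym (∣∣≡∑∈1 S)) short)))))
    ... | inj₁ _ | inj₁ y≡0 = suc≤ (≤-trans (pairs<2πK̄πK c) (m≤n+m*a+m*b _ _ _ _ (inj₂
                                (subst (λ t → 1 ≤ 1 ∸ t) (sym y≡0) ≤-refl))))
    ... | inj₁ full | inj₂ πK̄∸∣T∣≤∑set =
      suc≤ (≤-trans (pairs<deficit disjoint complete saturated enough-sets unsolvable)
                    (≤-trans (m≤m+n _ _) (m≤m+n _ _)))
      where
      saturated : ∀ i → i ∈ S → 1 ≤ SL.sat c i
      saturated i i∈S with indicator≡0⊎≤ 1 (SL.sat c i)
      ... | inj₁ x≡0   = contradiction (subst (1 ≤_) x≡0 (full i i∈S)) λ ()
      ... | inj₂ 1≤sat = 1≤sat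
      enough-sets : πK̄ ≤ ∑ (n K̄) (SL.set c) + ∣ T ∣
      enough-sets = ≤-trans (m≤n+m∸n πK̄ ∣ T ∣)
                      (≤-trans (+-monoʳ-≤ ∣ T ∣ πK̄∸∣T∣≤∑set) (≤-reflexive (+-comm ∣ T ∣ _)))

2πK̄πK≡2πGπH : ∀ s πG πH → 2 * (pickKbar s πG πH * pickK s πG πH) ≡ 2 * πG * πH
2πK̄πK≡2πGπH isG πG πH = trans (cong (2 *_) (*-comm πH πG)) (sym (*-assoc 2 πG πH))
2πK̄πK≡2πGπH isH πG πH = sym (*-assoc 2 πG πH)

theorem3 : (G H : SimpleGraph) → Connected G → Connected H →
    (πG πH : ℕ) → IsPebblingNumber G πG → IsPebblingNumber H πH →
    (rG : Fin (n G)) (rH : Fin (n H)) (s : Side) →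
    (S T : Subset (n (Kbar s G H))) →
    (∀ j → j ∈ S → j ∉ T) →
    (∀ i j → i ∈ S → j ∈ T → Adj (Kbar s G H) i j) →
    (c : ProdV G H → ℕ) →
    ¬ PebProd.Solvable G H c (rG , rH) →
    let open Slice s G H πG πH c
        M = 2 * πG * πH
    in ∑∈ S pair + 1 ≤
       ∑∈ T (λ j → πK ∸ extra j) + M * (∣ S ∣ ∸ ∑∈ S (λ i → x i 1))
         + M * (1 ∸ y (πK̄ ∸ ∣ T ∣))
theorem3 G H _ _ πG πH (pebG , _) (pebH , _) rG rH s S T disjoint complete c unsolvable
  with pt-surjective s G H (rG , rH)
... | rK , rK̄ , root≡ rewrite sym (2πK̄πK≡2πGπH s πG πH) =
  ProductPebbling.Transfer.pairs-bound G H πG πH pebG pebH s S rK rK̄ disjoint complete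
    (unsolvable ∘ subst (PebProd.Solvable G H c) root≡)
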